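{- Let $(F_i)_{i\ge0}$ be the Fibonacci numbers with $F_0=0$, $F_1=1$, $F_i=F_{i-1}+F_{i-2}$. Define multisets $A_g$ of non-negative integers for $g\ge 2$ recursively by $A_2=\{1,3\}$ and, for $g>2$, $$A_g = \{g+1\} \cup \Big(\bigcup_{m\in A_{g-1}} \{0,1,\dots,m-1\}\Big) \setminus \{g-2\},$$ where the union over $m\in A_{g-1}$ is taken with multiplicity (each element $m$ of $A_{g-1}$, counted with its multiplicity, contributes one copy of each of $0,1,\dots,m-1$), $\cup$ denotes multiset sum, and $\setminus\{g-2\}$ removes one copy of $g-2$. Then for every $g\ge 2$, the multiset $A_g$ consists of exactly $2F_{g-2-i}$ copies of $i$ for each $i=0,1,\dots,g-3$, together with one copy of $g-1$ and one copy of $g+1$; that is, $$A_g=\underbrace{\{0,\dots,0\}}_{2F_{g-2}}\cup\underbrace{\{1,\dots,1\}}_{2F_{g-3}}\cup\cdots\cup\underbrace{\{g-3,g-3\}}_{2F_1}\cup\{g-1,g+1\}.$$ Moreover $|A_g| = 2F_g$ (cardinality counted with multiplicity).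
   Context: Multisets are collections of elements with multiplicities; union of multisets adds multiplicities and removing $\{x\}$ removes a single copy of $x$. -}

module Defs where

open import Data.Nat using (ℕ; zero; suc; _+_; _*_; _∸_; _≟_)
open import Data.List using (List; []; _∷_; _++_; concatMap; upTo; replicate)
open import Relation.Nullary using (yes; no)

fib : ℕ → ℕ
fib zero = 0
fib (suc zero) = 1
fib (suc (suc n)) = fib (suc n) + fib n

-- Multisets of naturals are represented as lists, compared up to
-- permutation (_↭_). Multiset sum is _++_.

removeOne : ℕ → List ℕ → List ℕ
removeOne x [] = []
removeOne x (y ∷ ys) with x ≟ y
... | yes _ = ys
... | no _ = y ∷ removeOne x ys

-- A g for g ≥ 2 (values at g = 0, 1 are irrelevant, set to [])
-- A 2 = {1,3};  A g = {g+1} ∪ (⊎_{m ∈ A (g-1)} {0,…,m-1}) ∖ {g-2}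
A : ℕ → List ℕ
A zero = []
A (suc zero) = []
A (suc (suc zero)) = 1 ∷ 3 ∷ []
A (suc (suc (suc k))) =
  (suc (suc (suc k)) + 1) ∷ removeOne (suc k) (concatMap upTo (A (suc (suc k))))

target : ℕ → List ℕ
target g = concatMap (λ i → replicate (2 * fib (g ∸ 2 ∸ i)) i) (upTo (g ∸ 2))
           ++ ((g ∸ 1) ∷ (g + 1) ∷ [])

-- Let M n be the multiset with 2 F(n - i) copies of each i < n; the claim is
-- A (n + 2) = M n ∪ {n + 1, n + 3}. Now M (n + 1) is 2 F(n + 1) zeros together with
-- M n shifted up by one, and since [0, m + 1) is a zero plus [0, m) shifted, the
-- intervals [0, m) over m ∈ M n together with two copies of [0, n + 1) make up
-- M (n + 1): the zero count |M n| + 2 = 2 F(n + 2) is exactly the Fibonacci step.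
-- In the recursion for A the extra intervals are [0, n + 1) and
-- [0, n + 3) = [0, n + 1) ∪ {n + 1, n + 2}, and the removed copy of n + 1 is the
-- surplus one, leaving M (n + 1) ∪ {n + 2}.
module Submission where

open import Defs
open import Data.Nat using (ℕ; zero; suc; _+_; _*_; _∸_; _≤_; _≟_; s≤s; z≤n)
open import Data.Nat.Properties using (+-comm; +-assoc; *-distribˡ-+)
open import Data.List using (List; []; _∷_; _++_; [_]; length; map; concatMap; upTo; replicate)
open import Data.List.Properties
  using (map-++; ++-assoc; ++-identityʳ; map-upTo; upTo-∷ʳ; concatMap-++; concatMap-map;
         concatMap-cong; map-concatMap; map-replicate; length-++; length-map; length-replicate)
open import Data.List.Membership.Propositional using (_∈_)
open import Data.List.Relation.Unary.Any using (here; there)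
open import Data.List.Relation.Binary.Permutation.Propositional
  using (_↭_; refl; prep; swap; trans; ↭-sym; ↭-reflexive; module PermutationReasoning)
open import Data.List.Relation.Binary.Permutation.Propositional.Properties
  using (shift; shifts; ∷↭∷ʳ; drop-∷; ∈-resp-↭; ++⁺ˡ; ++⁺ʳ; ++⁺; map⁺; ↭-length)
open import Data.Product using (_×_; _,_)
open import Data.Empty using (⊥-elim)
open import Relation.Nullary using (yes; no)
open import Relation.Binary.PropositionalEquality
  using (_≡_; cong; cong₂; sym; module ≡-Reasoning)
  renaming (refl to ≡-refl; trans to ≡-trans)

↭-removeOne : ∀ {x} xs → x ∈ xs → xs ↭ x ∷ removeOne x xs
↭-removeOne {x} (y ∷ ys) x∈xs with x ≟ y
↭-removeOne (y ∷ ys) _            | yes ≡-refl = refl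
↭-removeOne (y ∷ ys) (here x≡y)   | no x≢y = ⊥-elim (x≢y x≡y)
↭-removeOne (y ∷ ys) (there x∈ys) | no _   = trans (prep y (↭-removeOne ys x∈ys)) (swap y _ refl)

removeOne-↭ : ∀ {x xs ys} → xs ↭ x ∷ ys → removeOne x xs ↭ ys
removeOne-↭ {x} {xs} xs↭x∷ys =
  drop-∷ (trans (↭-sym (↭-removeOne xs (∈-resp-↭ (↭-sym xs↭x∷ys) (here ≡-refl)))) xs↭x∷ys)

concatMap⁺ : ∀ {A B : Set} (f : A → List B) {xs ys} → xs ↭ ys → concatMap f xs ↭ concatMap f ys
concatMap⁺ f refl         = refl
concatMap⁺ f (prep x p)   = ++⁺ˡ (f x) (concatMap⁺ f p)
concatMap⁺ f (swap x y p) = trans (shifts (f x) (f y)) (++⁺ˡ (f y) (++⁺ˡ (f x) (concatMap⁺ f p)))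
concatMap⁺ f (trans p q)  = trans (concatMap⁺ f p) (concatMap⁺ f q)

intervals : List ℕ → List ℕ
intervals = concatMap upTo

raise : ℕ → List ℕ → List ℕ
raise k xs = replicate k 0 ++ map suc xs

raise-++ : ∀ j k xs ys → raise j xs ++ raise k ys ↭ raise (j + k) (xs ++ ys)
raise-++ (suc j) k xs ys = prep 0 (raise-++ j k xs ys)
raise-++ zero    k xs ys = begin
  map suc xs ++ replicate k 0 ++ map suc ys  ↭⟨ shifts (map suc xs) (replicate k 0) ⟩
  replicate k 0 ++ map suc xs ++ map suc ys  ≡⟨ cong (replicate k 0 ++_) (map-++ suc xs ys) ⟨
  raise k (xs ++ ys)                         ∎
  where open PermutationReasoning

upTo-suc : ∀ n → upTo (suc n) ≡ raise 1 (upTo n)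
upTo-suc n = cong (0 ∷_) (sym (map-upTo suc n))

intervals-raise : ∀ k xs → intervals (raise k xs) ↭ raise (length xs) (intervals xs)
intervals-raise (suc k) xs       = intervals-raise k xs
intervals-raise zero    []       = refl
intervals-raise zero    (m ∷ xs) = begin
  upTo (suc m) ++ intervals (map suc xs)              ≡⟨ cong (_++ intervals (map suc xs)) (upTo-suc m) ⟩
  raise 1 (upTo m) ++ intervals (map suc xs)          ↭⟨ ++⁺ˡ (raise 1 (upTo m)) (intervals-raise 0 xs) ⟩
  raise 1 (upTo m) ++ raise (length xs) (intervals xs) ↭⟨ raise-++ 1 (length xs) (upTo m) (intervals xs) ⟩
  raise (suc (length xs)) (intervals (m ∷ xs))        ∎
  where open PermutationReasoning

fibMultiset : ℕ → List ℕ
fibMultiset zero    = []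
fibMultiset (suc n) = raise (2 * fib (suc n)) (fibMultiset n)

length-raise : ∀ k xs → length (raise k xs) ≡ k + length xs
length-raise k xs = ≡-trans (length-++ (replicate k 0))
                            (cong₂ _+_ (length-replicate k) (length-map suc xs))

length-fibMultiset : ∀ n → length (fibMultiset n) + 2 ≡ 2 * fib (suc (suc n))
length-fibMultiset zero    = ≡-refl
length-fibMultiset (suc n) = begin
  length (fibMultiset (suc n)) + 2                    ≡⟨ cong (_+ 2) (length-raise (2 * fib (suc n)) (fibMultiset n)) ⟩
  2 * fib (suc n) + length (fibMultiset n) + 2         ≡⟨ +-assoc (2 * fib (suc n)) _ 2 ⟩
  2 * fib (suc n) + (length (fibMultiset n) + 2)       ≡⟨ cong (2 * fib (suc n) +_) (length-fibMultiset n) ⟩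
  2 * fib (suc n) + 2 * fib (suc (suc n))              ≡⟨ +-comm (2 * fib (suc n)) _ ⟩
  2 * fib (suc (suc n)) + 2 * fib (suc n)              ≡⟨ *-distribˡ-+ 2 (fib (suc (suc n))) (fib (suc n)) ⟨
  2 * fib (suc (suc (suc n)))                          ∎
  where open ≡-Reasoning

intervals-fibMultiset : ∀ n →
  intervals (fibMultiset n) ++ upTo (suc n) ++ upTo (suc n) ↭ fibMultiset (suc n)
intervals-fibMultiset zero    = refl
intervals-fibMultiset (suc n) = begin
  intervals (fibMultiset (suc n)) ++ upTo (suc (suc n)) ++ upTo (suc (suc n))
    ≡⟨ cong (λ u → intervals (fibMultiset (suc n)) ++ u ++ u) (upTo-suc (suc n)) ⟩
  intervals (raise F M) ++ raise 1 U ++ raise 1 U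
    ↭⟨ ++⁺ (intervals-raise F M) (raise-++ 1 1 U U) ⟩
  raise (length M) (intervals M) ++ raise 2 (U ++ U)
    ↭⟨ raise-++ (length M) 2 (intervals M) (U ++ U) ⟩
  raise (length M + 2) (intervals M ++ U ++ U)
    ≡⟨ cong (λ k → raise k (intervals M ++ U ++ U)) (length-fibMultiset n) ⟩
  raise (2 * fib (suc (suc n))) (intervals M ++ U ++ U)
    ↭⟨ ++⁺ˡ (replicate (2 * fib (suc (suc n))) 0) (map⁺ suc (intervals-fibMultiset n)) ⟩
  fibMultiset (suc (suc n)) ∎
  where
  open PermutationReasoning
  F = 2 * fib (suc n)
  M = fibMultiset n
  U = upTo (suc n)

upTo-+2 : ∀ n → upTo (suc (suc n)) ≡ upTo n ++ n ∷ suc n ∷ []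
upTo-+2 n = begin
  upTo (suc (suc n))            ≡⟨ upTo-∷ʳ (suc n) ⟨
  upTo (suc n) ++ [ suc n ]     ≡⟨ cong (_++ [ suc n ]) (upTo-∷ʳ n) ⟨
  (upTo n ++ [ n ]) ++ [ suc n ] ≡⟨ ++-assoc (upTo n) [ n ] [ suc n ] ⟩
  upTo n ++ n ∷ suc n ∷ []      ∎
  where open ≡-Reasoning

A-↭-fibMultiset : ∀ n → A (suc (suc n)) ↭ fibMultiset n ++ suc n ∷ suc (suc (suc n)) ∷ []
A-↭-fibMultiset zero    = refl
A-↭-fibMultiset (suc n) = begin
  A (suc (suc (suc n)))
    ≡⟨ cong (_∷ removeOne (suc n) (intervals (A (suc (suc n))))) (+-comm (suc (suc (suc n))) 1) ⟩
  suc (suc (suc (suc n))) ∷ removeOne (suc n) (intervals (A (suc (suc n))))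
    ↭⟨ prep (suc (suc (suc (suc n)))) (removeOne-↭ intervals-A) ⟩
  suc (suc (suc (suc n))) ∷ fibMultiset (suc n) ++ [ suc (suc n) ]
    ↭⟨ ∷↭∷ʳ _ (fibMultiset (suc n) ++ [ suc (suc n) ]) ⟩
  (fibMultiset (suc n) ++ [ suc (suc n) ]) ++ [ suc (suc (suc (suc n))) ]
    ≡⟨ ++-assoc (fibMultiset (suc n)) _ _ ⟩
  fibMultiset (suc n) ++ suc (suc n) ∷ suc (suc (suc (suc n))) ∷ [] ∎
  where
  open PermutationReasoning
  M = fibMultiset n
  U = upTo (suc n)
  intervals-A : intervals (A (suc (suc n))) ↭ suc n ∷ fibMultiset (suc n) ++ [ suc (suc n) ]
  intervals-A = begin
    intervals (A (suc (suc n)))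
      ↭⟨ concatMap⁺ upTo (A-↭-fibMultiset n) ⟩
    intervals (M ++ suc n ∷ suc (suc (suc n)) ∷ [])
      ≡⟨ concatMap-++ upTo M _ ⟩
    intervals M ++ U ++ upTo (suc (suc (suc n))) ++ []
      ≡⟨ cong (λ u → intervals M ++ U ++ u) (≡-trans (++-identityʳ _) (upTo-+2 (suc n))) ⟩
    intervals M ++ U ++ U ++ suc n ∷ suc (suc n) ∷ []
      ≡⟨ ≡-trans (cong (intervals M ++_) (sym (++-assoc U U _))) (sym (++-assoc (intervals M) (U ++ U) _)) ⟩
    (intervals M ++ U ++ U) ++ [ suc n ] ++ [ suc (suc n) ]
      ↭⟨ shift (suc n) (intervals M ++ U ++ U) _ ⟩
    suc n ∷ (intervals M ++ U ++ U) ++ [ suc (suc n) ]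
      ↭⟨ prep (suc n) (++⁺ʳ _ (intervals-fibMultiset n)) ⟩
    suc n ∷ fibMultiset (suc n) ++ [ suc (suc n) ] ∎

fibMultiset-counts : ∀ n → concatMap (λ i → replicate (2 * fib (n ∸ i)) i) (upTo n) ≡ fibMultiset n
fibMultiset-counts zero    = ≡-refl
fibMultiset-counts (suc n) = begin
  concatMap (copies (suc n)) (upTo (suc n))
    ≡⟨ cong (concatMap (copies (suc n))) (upTo-suc n) ⟩
  replicate (2 * fib (suc n)) 0 ++ concatMap (copies (suc n)) (map suc (upTo n))
    ≡⟨ cong (replicate (2 * fib (suc n)) 0 ++_) shift-copies ⟩
  replicate (2 * fib (suc n)) 0 ++ map suc (fibMultiset n) ∎
  where
  open ≡-Reasoning
  copies : ℕ → ℕ → List ℕ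
  copies m i = replicate (2 * fib (m ∸ i)) i
  shift-copies : concatMap (copies (suc n)) (map suc (upTo n)) ≡ map suc (fibMultiset n)
  shift-copies = begin
    concatMap (copies (suc n)) (map suc (upTo n))
      ≡⟨ concatMap-map (copies (suc n)) suc (upTo n) ⟩
    concatMap (λ i → replicate (2 * fib (n ∸ i)) (suc i)) (upTo n)
      ≡⟨ concatMap-cong (λ i → sym (map-replicate suc (2 * fib (n ∸ i)) i)) (upTo n) ⟩
    concatMap (λ i → map suc (copies n i)) (upTo n)
      ≡⟨ map-concatMap suc (copies n) (upTo n) ⟨
    map suc (concatMap (copies n) (upTo n))
      ≡⟨ cong (map suc) (fibMultiset-counts n) ⟩
    map suc (fibMultiset n) ∎

lemma1 : (g : ℕ) → 2 ≤ g → (A g ↭ target g) × (length (A g) ≡ 2 * fib g)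
lemma1 (suc (suc n)) (s≤s (s≤s z≤n)) = A↭target , length-A
  where
  target-≡ : target (suc (suc n)) ≡ fibMultiset n ++ suc n ∷ suc (suc (suc n)) ∷ []
  target-≡ = cong₂ (λ xs m → xs ++ suc n ∷ m ∷ []) (fibMultiset-counts n) (+-comm (suc (suc n)) 1)

  A↭target : A (suc (suc n)) ↭ target (suc (suc n))
  A↭target = trans (A-↭-fibMultiset n) (↭-reflexive (sym target-≡))

  length-A : length (A (suc (suc n))) ≡ 2 * fib (suc (suc n))
  length-A = ≡-trans (↭-length (A-↭-fibMultiset n))
                     (≡-trans (length-++ (fibMultiset n)) (length-fibMultiset n))
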